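{- Let $T$ be a decorated tree and $[P,Q]=\mathrm{I}(T)$. For a free leaf $\ell$ of $T$, let $P_\ell$ be the initial segment of $P$ produced by the traversal up to and including the down steps appended when visiting $\ell$. Then $P_\ell$ is a Dyck path.
   Context: Decorated trees: depth of the root is $0$, traversal order is preorder (left-to-right depth-first). A decorated tree is a rooted plane tree with at least one edge, each leaf labeled by an integer $\ge-1$, such that (1) each leaf label is strictly less than the depth of its parent; (2) every internal node of depth $p>0$ has a descendant leaf labeled $\le p-2$; (3) for every internal node $t$ of depth $p$, every subtree $T''$ rooted at a child of $t$ and every leaf $\ell$ of $T''$ labeled $p$, the leaves of $T''$ preceding $\ell$ have labels $\ge p$. A free leaf is a leaf labeled $-1$. A Dyck path is a nonempty word in $u$ (up step) and $d$ (down step) with as many $u$ as $d$ and every prefix having at least as many $u$ as $d$. The map $\mathrm{I}$: for a non-root internal node $x$ of depth $p$, its certificate is the first leaf in traversal order among the descendants of $x$ with label at most $p-2$. For a leaf $\ell$, $c(\ell)$ is the number of non-root internal nodes whose certificate is $\ell$. Perform a left-to-right depth-first traversal of $T$. $\mathrm{Q}(T)$ records the depth variation: $u$ each time an edge is descended and $d$ each time it is ascended. $\mathrm{P}(T)$ starts empty; each time a new edge is descended append $u$, and each time a leaf $\ell$ is reached append $d^{c(\ell)+1}$ (nothing else is appended). Then $\mathrm{I}(T)=[\mathrm{P}(T),\mathrm{Q}(T)]$. -}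

module Defs where

open import Data.Nat using (ℕ; zero; suc)
import Data.Nat as ℕ
open import Data.Integer using (ℤ; +_; -[1+_]; _≤_; _<_; _-_; _≤?_)
open import Data.List using (List; []; _∷_; _++_; [_]; length; filter; concatMap; replicate; take)
open import Data.List.Properties using (≡-dec)
open import Data.List.Relation.Unary.All using (All)
open import Data.List.Relation.Unary.Any using (Any)
open import Data.Product using (_×_; _,_; Σ)
open import Data.Maybe using (Maybe; just; nothing)
open import Relation.Nullary using (¬_; does)
open import Relation.Binary.PropositionalEquality using (_≡_)
open import Data.Empty using (⊥)
open import Data.Bool using (Bool; true; false; if_then_else_)

-- Plane trees whose leaves carry integer labels.
-- A node with an empty child list is excluded by 'Decorated' below,
-- so internal nodes are exactly the 'node' constructors.

data Tree : Set where
  leaf : ℤ → Tree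
  node : List Tree → Tree

-- Nodes are identified by their address: the list of child indices
-- (0-based) along the path from the root.
Address : Set
Address = List ℕ

mutual
  subs : Address → ℕ → Tree → List (Address × ℕ × Tree)
  subs a p (leaf x)  = (a , p , leaf x) ∷ []
  subs a p (node ts) = (a , p , node ts) ∷ subsL a (suc p) 0 ts

  subsL : Address → ℕ → ℕ → List Tree → List (Address × ℕ × Tree)
  subsL a p i []       = []
  subsL a p i (t ∷ ts) = subs (a ++ [ i ]) p t ++ subsL a p (suc i) ts

mutual
  leavesA : Address → Tree → List (Address × ℤ)
  leavesA a (leaf x)  = (a , x) ∷ []
  leavesA a (node ts) = leavesAL a 0 ts

  leavesAL : Address → ℕ → List Tree → List (Address × ℤ)
  leavesAL a i []       = []
  leavesAL a i (t ∷ ts) = leavesA (a ++ [ i ]) t ++ leavesAL a (suc i) ts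

mutual
  labels : Tree → List ℤ
  labels (leaf x)  = x ∷ []
  labels (node ts) = labelsL ts

  labelsL : List Tree → List ℤ
  labelsL []       = []
  labelsL (t ∷ ts) = labels t ++ labelsL ts

Cond3 : ℕ → List ℤ → Set
Cond3 p ls = ∀ xs ys → ls ≡ xs ++ (+ p) ∷ ys → All (λ y → + p ≤ y) xs

NodeOK : ℕ → Tree → Set
NodeOK p (leaf x)  = (-[1+ 0 ] ≤ x) × (x < (+ p) - (+ 1))   -- label ≥ -1 and (1): label < depth of parent
NodeOK zero (node ts) =
  ¬ (ts ≡ []) × All (λ c → Cond3 zero (labels c)) ts
NodeOK (suc q) (node ts) =
  ¬ (ts ≡ []) ×
  Any (λ y → y ≤ (+ suc q) - (+ 2)) (labels (node ts)) ×
  All (λ c → Cond3 (suc q) (labels c)) ts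

-- A decorated tree: the root is internal (so there is at least one edge)
-- and every node satisfies the local conditions.
Decorated : Tree → Set
Decorated (leaf x)  = ⊥
Decorated (node ts) = All (λ { (a , p , s) → NodeOK p s }) (subs [] 0 (node ts))

firstWith : (ℤ → Bool) → List (Address × ℤ) → Maybe Address
firstWith f []             = nothing
firstWith f ((a , x) ∷ ls) = if f x then just a else firstWith f ls

certOf : Address × ℕ × Tree → Maybe Address
certOf (a , zero , s)        = nothing
certOf (a , suc q , leaf x)  = nothing
certOf (a , suc q , node ts) =
  firstWith (λ y → does (y ≤? (+ suc q) - (+ 2))) (leavesA a (node ts))

catMaybes : {A : Set} → List (Maybe A) → List A
catMaybes []             = []
catMaybes (nothing ∷ xs) = catMaybes xs
catMaybes (just x ∷ xs)  = x ∷ catMaybes xs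

certificates : Tree → List Address
certificates T = catMaybes (Data.List.map certOf (subs [] 0 T))

cnt : Tree → Address → ℕ
cnt T ℓ = length (filter (λ a → ≡-dec ℕ._≟_ a ℓ) (certificates T))

data Step : Set where
  u d : Step

data Event : Set where
  descend ascend : Event
  visit : Address → Event

mutual
  traverse : Address → Tree → List Event
  traverse a (leaf x)  = visit a ∷ []
  traverse a (node ts) = traverseL a 0 ts

  traverseL : Address → ℕ → List Tree → List Event
  traverseL a i []       = []
  traverseL a i (t ∷ ts) =
    descend ∷ traverse (a ++ [ i ]) t ++ ascend ∷ traverseL a (suc i) ts

events : Tree → List Event
events T = traverse [] T

Qstep : Event → List Step
Qstep descend   = u ∷ []
Qstep ascend    = d ∷ []
Qstep (visit _) = []

Pstep : Tree → Event → List Step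
Pstep T descend   = u ∷ []
Pstep T ascend    = []
Pstep T (visit ℓ) = replicate (suc (cnt T ℓ)) d

Q : Tree → List Step
Q T = concatMap Qstep (events T)

P : Tree → List Step
P T = concatMap (Pstep T) (events T)

upToVisit : Address → List Event → List Event
upToVisit ℓ []              = []
upToVisit ℓ (visit a ∷ es)  with does (≡-dec ℕ._≟_ a ℓ)
... | true  = visit a ∷ []
... | false = visit a ∷ upToVisit ℓ es
upToVisit ℓ (e ∷ es)        = e ∷ upToVisit ℓ es

Pprefix : Tree → Address → List Step
Pprefix T ℓ = concatMap (Pstep T) (upToVisit ℓ (events T))

mutual
  at : Tree → Address → Maybe Tree
  at t []                = just t
  at (leaf x) (i ∷ a)    = nothing
  at (node ts) (i ∷ a)   = atL ts i a

  atL : List Tree → ℕ → Address → Maybe Tree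
  atL [] i a             = nothing
  atL (t ∷ ts) zero a    = at t a
  atL (t ∷ ts) (suc i) a = atL ts i a

FreeLeaf : Tree → Address → Set
FreeLeaf T ℓ = at T ℓ ≡ just (leaf -[1+ 0 ])

height : List Step → ℤ
height []       = + 0
height (u ∷ w)  = (height w) Data.Integer.+ (+ 1)
height (d ∷ w)  = (height w) - (+ 1)

IsDyck : List Step → Set
IsDyck w = ¬ (w ≡ []) × height w ≡ + 0 × (∀ k → + 0 ≤ height (take k w))

-- Read the traversal with a stack holding the threshold p − 2 of every non-root internal
-- ancestor (of depth p) whose certificate has not been visited yet. A leaf labelled y is
-- the certificate of exactly the stacked thresholds ≥ y, so c(ℓ) is their number and they
-- leave the stack. Every u of P enters a node, every d visits a leaf or certifies a node,
-- and by condition (2) an internal node is certified inside its own subtree. Hence the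
-- P-word of a subtree entered with stack qs ends 1 + k below where it starts, k being the
-- number of thresholds of qs it certifies, and never goes below −(|qs| + 1). At the root the stack
-- is empty, so P stays ≥ 0; and since all thresholds are ≥ −1, a free leaf certifies every
-- pending threshold, which brings the height back exactly to 0.

module Submission where

open import Defs
open import Data.Bool using (true; false)
open import Data.Empty using (⊥-elim)
open import Data.Integer using (ℤ; +_; -[1+_]; -_; _+_; _-_; _≤_; _≤?_)
import Data.Integer as ℤ
import Data.Integer.Properties as ℤP
open import Data.Integer.Tactic.RingSolver using (solve-∀)
open import Data.List using (List; []; _∷_; _++_; [_]; length; filter; concatMap; replicate; take; map; foldl)
open import Data.List.Properties
  using (≡-dec; ++-identityʳ; ++-assoc; ++-cancelˡ; ∷-injective; map-++; concatMap-++; foldl-++;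
         length-++; length-filter; filter-++; filter-all; filter-reject)
open import Data.List.Relation.Unary.All as All using (All; []; _∷_)
import Data.List.Relation.Unary.All.Properties as AllP
open import Data.List.Relation.Unary.AllPairs using (AllPairs; []; _∷_)
import Data.List.Relation.Unary.AllPairs.Properties as AllPairsP
open import Data.List.Relation.Unary.Any using (Any; here; there)
open import Data.Maybe using (Maybe; just; nothing)
import Data.Maybe.Relation.Unary.All as Maybe
open import Data.Nat as ℕ using (ℕ; zero; suc; z≤n; s≤s)
import Data.Nat.Properties as ℕP
open import Data.Product using (_×_; _,_; ∃-syntax; proj₁; proj₂)
open import Data.Sum using (_⊎_; inj₁; inj₂)
open import Data.Unit using (⊤; tt)
open import Level using (0ℓ)
open import Relation.Binary.PropositionalEquality hiding ([_])
open import Relation.Nullary using (¬_; does; yes; no)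
open import Relation.Unary using (Pred; Decidable)
open import Relation.Unary.Properties using (∁?)

-- Heights of words

take-++-⊎ : ∀ {A : Set} k (xs ys : List A) →
  take k (xs ++ ys) ≡ take k xs ⊎ ∃[ j ] take k (xs ++ ys) ≡ xs ++ take j ys
take-++-⊎ k [] ys = inj₂ (k , refl)
take-++-⊎ zero (x ∷ xs) ys = inj₁ refl
take-++-⊎ (suc k) (x ∷ xs) ys with take-++-⊎ k xs ys
... | inj₁ eq = inj₁ (cong (x ∷_) eq)
... | inj₂ (j , eq) = inj₂ (j , cong (x ∷_) eq)

take-≡-take-++ : ∀ {A : Set} k (xs ys : List A) → ∃[ j ] take k xs ≡ take j (xs ++ ys)
take-≡-take-++ zero xs ys = 0 , refl
take-≡-take-++ (suc k) [] ys = 0 , refl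
take-≡-take-++ (suc k) (x ∷ xs) ys with take-≡-take-++ k xs ys
... | j , eq = suc j , cong (x ∷_) eq

height-∷ : ∀ s w → height (s ∷ w) ≡ height [ s ] + height w
height-∷ u w = ℤP.+-comm (height w) (+ 1)
height-∷ d w = ℤP.+-comm (height w) -[1+ 0 ]

height-++ : ∀ xs ys → height (xs ++ ys) ≡ height xs + height ys
height-++ [] ys = sym (ℤP.+-identityˡ (height ys))
height-++ (s ∷ xs) ys = begin
  height (s ∷ xs ++ ys)                   ≡⟨ height-∷ s (xs ++ ys) ⟩
  height [ s ] + height (xs ++ ys)        ≡⟨ cong (λ h → height [ s ] + h) (height-++ xs ys) ⟩
  height [ s ] + (height xs + height ys)  ≡⟨ sym (ℤP.+-assoc (height [ s ]) (height xs) (height ys)) ⟩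
  height [ s ] + height xs + height ys    ≡⟨ cong (_+ height ys) (sym (height-∷ s xs)) ⟩
  height (s ∷ xs) + height ys             ∎
  where open ≡-Reasoning

height-replicate-d : ∀ n → height (replicate n d) ≡ - + n
height-replicate-d zero = refl
height-replicate-d (suc n) = begin
  height (replicate n d) - + 1  ≡⟨ cong (_- + 1) (height-replicate-d n) ⟩
  - + n - + 1                   ≡⟨ neg-suc (+ n) ⟩
  - + suc n                     ∎
  where
  open ≡-Reasoning
  neg-suc : ∀ x → - x - + 1 ≡ - (+ 1 + x)
  neg-suc = solve-∀

height-u∷ : ∀ {w n c} → height w + + suc n ≡ c → height (u ∷ w) + + n ≡ c
height-u∷ {w} {n} {c} eq = begin
  height (u ∷ w) + + n    ≡⟨ cong (_+ + n) (height-∷ u w) ⟩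
  + 1 + height w + + n    ≡⟨ shift (height w) (+ n) ⟩
  height w + (+ 1 + + n)  ≡⟨ eq ⟩
  c                       ∎
  where
  open ≡-Reasoning
  shift : ∀ x y → + 1 + x + y ≡ x + (+ 1 + y)
  shift = solve-∀

height-u∷-++ : ∀ {xs ys n m c} → height xs + + suc n ≡ + m → height ys + + m ≡ c →
  height (u ∷ xs ++ ys) + + n ≡ c
height-u∷-++ {xs} {ys} {n} {m} {c} eq₁ eq₂ = height-u∷ {xs ++ ys} (begin
  height (xs ++ ys) + + suc n        ≡⟨ cong (_+ + suc n) (height-++ xs ys) ⟩
  height xs + height ys + + suc n    ≡⟨ swap (height xs) (height ys) (+ suc n) ⟩
  height ys + (height xs + + suc n)  ≡⟨ cong (λ h → height ys + h) eq₁ ⟩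
  height ys + + m                    ≡⟨ eq₂ ⟩
  c                                  ∎)
  where
  open ≡-Reasoning
  swap : ∀ x y z → x + y + z ≡ y + (x + z)
  swap = solve-∀

PrefixHeights≥ : ℤ → List Step → Set
PrefixHeights≥ c w = ∀ k → c ≤ height (take k w)

prefixHeights-mono : ∀ {c c′ w} → c ≤ c′ → PrefixHeights≥ c′ w → PrefixHeights≥ c w
prefixHeights-mono c≤c′ h k = ℤP.≤-trans c≤c′ (h k)

prefixHeights-++ : ∀ {c c′ xs ys} → PrefixHeights≥ c xs → PrefixHeights≥ c′ ys →
  c ≤ height xs + c′ → PrefixHeights≥ c (xs ++ ys)
prefixHeights-++ {c} {c′} {xs} {ys} hxs hys c≤ k with take-++-⊎ k xs ys
... | inj₁ eq = subst (λ w → c ≤ height w) (sym eq) (hxs k)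
... | inj₂ (j , eq) = begin
  c                               ≤⟨ c≤ ⟩
  height xs + c′                  ≤⟨ ℤP.+-monoʳ-≤ (height xs) (hys j) ⟩
  height xs + height (take j ys)  ≡⟨ sym (height-++ xs (take j ys)) ⟩
  height (xs ++ take j ys)        ≡⟨ cong height (sym eq) ⟩
  height (take k (xs ++ ys))      ∎
  where open ℤP.≤-Reasoning

prefixHeights-++⁻ˡ : ∀ {c} xs ys → PrefixHeights≥ c (xs ++ ys) → PrefixHeights≥ c xs
prefixHeights-++⁻ˡ {c} xs ys h k with take-≡-take-++ k xs ys
... | j , eq = subst (λ w → c ≤ height w) (sym eq) (h j)

prefixHeights-u∷ : ∀ {c c′ w} → c ≤ + 0 → PrefixHeights≥ c′ w → c ≤ + 1 + c′ →
  PrefixHeights≥ c (u ∷ w)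
prefixHeights-u∷ c≤0 h c≤ zero = c≤0
prefixHeights-u∷ {c} {c′} {w} c≤0 h c≤ (suc k) = begin
  c                        ≤⟨ c≤ ⟩
  + 1 + c′                 ≤⟨ ℤP.+-monoʳ-≤ (+ 1) (h k) ⟩
  + 1 + height (take k w)  ≡⟨ sym (height-∷ u (take k w)) ⟩
  height (u ∷ take k w)    ∎
  where open ℤP.≤-Reasoning

prefixHeights-replicate-d : ∀ n → PrefixHeights≥ (- + n) (replicate n d)
prefixHeights-replicate-d zero zero = ℤP.≤-refl
prefixHeights-replicate-d zero (suc k) = ℤP.≤-refl
prefixHeights-replicate-d (suc n) zero = ℤP.neg-≤-pos
prefixHeights-replicate-d (suc n) (suc k) = begin
  - + suc n                                   ≡⟨ neg-suc (+ n) ⟩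
  -[1+ 0 ] + - + n                            ≤⟨ ℤP.+-monoʳ-≤ -[1+ 0 ] (prefixHeights-replicate-d n k) ⟩
  -[1+ 0 ] + height (take k (replicate n d))  ≡⟨ sym (height-∷ d (take k (replicate n d))) ⟩
  height (d ∷ take k (replicate n d))         ∎
  where
  open ℤP.≤-Reasoning
  neg-suc : ∀ x → - (+ 1 + x) ≡ - + 1 + - x
  neg-suc = solve-∀

-- Stacks of pending thresholds

length-filter+length-filter-∁ : ∀ {A : Set} {P : Pred A 0ℓ} (P? : Decidable P) xs →
  length (filter P? xs) ℕ.+ length (filter (∁? P?) xs) ≡ length xs
length-filter+length-filter-∁ P? [] = refl
length-filter+length-filter-∁ P? (x ∷ xs) with does (P? x)
... | true = cong suc (length-filter+length-filter-∁ P? xs)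
... | false = trans (ℕP.+-suc _ _) (cong suc (length-filter+length-filter-∁ P? xs))

length-∷ʳ : ∀ {A : Set} (xs : List A) x → length (xs ++ [ x ]) ≡ suc (length xs)
length-∷ʳ xs x = trans (length-++ xs) (ℕP.+-comm (length xs) 1)

certified : ℤ → List ℤ → List ℤ
certified y = filter (y ≤?_)

uncertified : ℤ → List ℤ → List ℤ
uncertified y = filter (∁? (y ≤?_))

pendingAfter : List ℤ → List ℤ → List ℤ
pendingAfter = foldl (λ qs y → uncertified y qs)

pendingAfter-[] : ∀ ys → pendingAfter [] ys ≡ []
pendingAfter-[] [] = refl
pendingAfter-[] (y ∷ ys) = pendingAfter-[] ys

pendingAfter-++ˡ : ∀ qs qs′ ys → pendingAfter (qs ++ qs′) ys ≡ pendingAfter qs ys ++ pendingAfter qs′ ys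
pendingAfter-++ˡ qs qs′ [] = refl
pendingAfter-++ˡ qs qs′ (y ∷ ys) = trans
  (cong (λ zs → pendingAfter zs ys) (filter-++ (∁? (y ≤?_)) qs qs′))
  (pendingAfter-++ˡ (uncertified y qs) (uncertified y qs′) ys)

pendingAfter-certifying : ∀ t ys → Any (_≤ t) ys → pendingAfter [ t ] ys ≡ []
pendingAfter-certifying t (y ∷ ys) (here y≤t) =
  trans (cong (λ zs → pendingAfter zs ys) (filter-reject (∁? (y ≤?_)) λ y≰t → y≰t y≤t)) (pendingAfter-[] ys)
pendingAfter-certifying t (y ∷ ys) (there any) with does (∁? (y ≤?_) t)
... | true = pendingAfter-certifying t ys any
... | false = pendingAfter-[] ys

All-pendingAfter : ∀ {P : Pred ℤ 0ℓ} qs ys → All P qs → All P (pendingAfter qs ys)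
All-pendingAfter qs [] all = all
All-pendingAfter qs (y ∷ ys) all = All-pendingAfter (uncertified y qs) ys (AllP.filter⁺ (∁? (y ≤?_)) all)

length-certified-++ : ∀ y xs ys →
  length (certified y (xs ++ ys)) ≡ length (certified y xs) ℕ.+ length (certified y ys)
length-certified-++ y xs ys = trans (cong length (filter-++ (y ≤?_) xs ys)) (length-++ (certified y xs))

threshold-≥-1 : ∀ q → -[1+ 0 ] ≤ + suc q - + 2
threshold-≥-1 q = subst (-[1+ 0 ] ≤_) (shift (+ q)) (ℤP.+-monoˡ-≤ (- + 1) (ℤ.+≤+ {0} {q} z≤n))
  where
  shift : ∀ x → x - + 1 ≡ + 1 + x - + 2
  shift = solve-∀

-- Addresses of nodes and leaves

infix 4 _⊑_
_⊑_ : Address → Address → Set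
b ⊑ c = ∃[ z ] c ≡ b ++ z

⊑-siblings : ∀ a {i j c} → i ≢ j → a ++ [ i ] ⊑ c → ¬ (a ++ [ j ] ⊑ c)
⊑-siblings a {i} {j} i≢j (z , refl) (z′ , eq) = i≢j (proj₁ (∷-injective (++-cancelˡ a _ _ (begin
  a ++ i ∷ z          ≡⟨ sym (++-assoc a [ i ] z) ⟩
  (a ++ [ i ]) ++ z   ≡⟨ eq ⟩
  (a ++ [ j ]) ++ z′  ≡⟨ ++-assoc a [ j ] z′ ⟩
  a ++ j ∷ z′         ∎))))
  where open ≡-Reasoning

⊑-child : ∀ a i z → a ++ [ i ] ⊑ a ++ i ∷ z
⊑-child a i z = z , sym (++-assoc a [ i ] z)

⊑-trans : ∀ {a b c} → a ⊑ b → b ⊑ c → a ⊑ c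
⊑-trans {a} (z , refl) (z′ , refl) = z ++ z′ , ++-assoc a z z′

VisitsBelow : Address → Event → Set
VisitsBelow b (visit c) = b ⊑ c
VisitsBelow b _ = ⊤

mutual
  traverse-visitsBelow : ∀ b t → All (VisitsBelow b) (traverse b t)
  traverse-visitsBelow b (leaf y) = ([] , sym (++-identityʳ b)) ∷ []
  traverse-visitsBelow b (node ts) = traverseL-visitsBelow b 0 ts

  traverseL-visitsBelow : ∀ a i ts → All (VisitsBelow a) (traverseL a i ts)
  traverseL-visitsBelow a i [] = []
  traverseL-visitsBelow a i (t ∷ ts) = tt ∷ AllP.++⁺
    (All.map (λ {e} → parent e) (traverse-visitsBelow (a ++ [ i ]) t))
    (tt ∷ traverseL-visitsBelow a (suc i) ts)
    where
    parent : ∀ e → VisitsBelow (a ++ [ i ]) e → VisitsBelow a e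
    parent (visit c) below = ⊑-trans ([ i ] , refl) below
    parent descend _ = tt
    parent ascend _ = tt

upToVisit-hit : ∀ ℓ es → upToVisit ℓ (visit ℓ ∷ es) ≡ [ visit ℓ ]
upToVisit-hit ℓ es with ≡-dec ℕ._≟_ ℓ ℓ
... | yes _ = refl
... | no ℓ≢ℓ = ⊥-elim (ℓ≢ℓ refl)

NotVisiting : Address → Event → Set
NotVisiting ℓ (visit c) = c ≢ ℓ
NotVisiting ℓ _ = ⊤

upToVisit-skip : ∀ ℓ {xs} ys → All (NotVisiting ℓ) xs → upToVisit ℓ (xs ++ ys) ≡ xs ++ upToVisit ℓ ys
upToVisit-skip ℓ ys [] = refl
upToVisit-skip ℓ ys (_∷_ {visit c} c≢ℓ h) with ≡-dec ℕ._≟_ c ℓ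
... | yes c≡ℓ = ⊥-elim (c≢ℓ c≡ℓ)
... | no _ = cong (visit c ∷_) (upToVisit-skip ℓ ys h)
upToVisit-skip ℓ ys (_∷_ {descend} _ h) = cong (descend ∷_) (upToVisit-skip ℓ ys h)
upToVisit-skip ℓ ys (_∷_ {ascend} _ h) = cong (ascend ∷_) (upToVisit-skip ℓ ys h)

traverse-notVisiting-sibling : ∀ a {i j ℓ} t → i ≢ j → a ++ [ j ] ⊑ ℓ →
  All (NotVisiting ℓ) (traverse (a ++ [ i ]) t)
traverse-notVisiting-sibling a {i} {j} {ℓ} t i≢j below-j =
  All.map (λ {e} → avoid e) (traverse-visitsBelow (a ++ [ i ]) t)
  where
  avoid : ∀ e → VisitsBelow (a ++ [ i ]) e → NotVisiting ℓ e
  avoid (visit c) below-i refl = ⊑-siblings a i≢j below-i below-j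
  avoid descend _ = tt
  avoid ascend _ = tt

upToVisit-prefix : ∀ ℓ es → ∃[ rest ] upToVisit ℓ es ++ rest ≡ es
upToVisit-prefix ℓ [] = [] , refl
upToVisit-prefix ℓ (visit c ∷ es) with does (≡-dec ℕ._≟_ c ℓ)
... | true = es , refl
... | false = let rest , eq = upToVisit-prefix ℓ es in rest , cong (visit c ∷_) eq
upToVisit-prefix ℓ (descend ∷ es) = let rest , eq = upToVisit-prefix ℓ es in rest , cong (descend ∷_) eq
upToVisit-prefix ℓ (ascend ∷ es) = let rest , eq = upToVisit-prefix ℓ es in rest , cong (ascend ∷_) eq

BelowChildFrom : Address → ℕ → Address → Set
BelowChildFrom a i c = ∃[ j ] i ℕ.≤ j × a ++ [ j ] ⊑ c

below-child : ∀ {a i c} → a ++ [ i ] ⊑ c → BelowChildFrom a i c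
below-child {i = i} below = i , ℕP.≤-refl , below

belowChildFrom-suc : ∀ {a i c} → BelowChildFrom a (suc i) c → BelowChildFrom a i c
belowChildFrom-suc (j , i<j , below) = j , ℕP.<⇒≤ i<j , below

belowChildFrom-⊑ : ∀ {a i c} → BelowChildFrom a i c → a ⊑ c
belowChildFrom-⊑ {a} (j , _ , below) = ⊑-trans ([ j ] , refl) below

below-later-sibling-≢ : ∀ {a i c c′} → a ++ [ i ] ⊑ c → BelowChildFrom a (suc i) c′ → c ≢ c′
below-later-sibling-≢ {a} below-i (j , i<j , below-j) refl = ⊑-siblings a (ℕP.<⇒≢ i<j) below-i below-j

mutual
  leavesA-below : ∀ b t → All (λ e → b ⊑ proj₁ e) (leavesA b t)
  leavesA-below b (leaf y) = ([] , sym (++-identityʳ b)) ∷ []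
  leavesA-below b (node ts) = All.map belowChildFrom-⊑ (leavesAL-below b 0 ts)

  leavesAL-below : ∀ a i ts → All (λ e → BelowChildFrom a i (proj₁ e)) (leavesAL a i ts)
  leavesAL-below a i [] = []
  leavesAL-below a i (t ∷ ts) = AllP.++⁺
    (All.map below-child (leavesA-below (a ++ [ i ]) t))
    (All.map belowChildFrom-suc (leavesAL-below a (suc i) ts))

Distinct : List (Address × ℤ) → Set
Distinct = AllPairs (λ e e′ → proj₁ e ≢ proj₁ e′)

mutual
  leavesA-distinct : ∀ b t → Distinct (leavesA b t)
  leavesA-distinct b (leaf y) = [] ∷ []
  leavesA-distinct b (node ts) = leavesAL-distinct b 0 ts

  leavesAL-distinct : ∀ a i ts → Distinct (leavesAL a i ts)
  leavesAL-distinct a i [] = []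
  leavesAL-distinct a i (t ∷ ts) = AllPairsP.++⁺ (leavesA-distinct (a ++ [ i ]) t) (leavesAL-distinct a (suc i) ts)
    (All.map (λ below-i → All.map (below-later-sibling-≢ below-i) (leavesAL-below a (suc i) ts))
      (leavesA-below (a ++ [ i ]) t))

mutual
  labels-leavesA : ∀ b t → map proj₂ (leavesA b t) ≡ labels t
  labels-leavesA b (leaf y) = refl
  labels-leavesA b (node ts) = labels-leavesAL b 0 ts

  labels-leavesAL : ∀ a i ts → map proj₂ (leavesAL a i ts) ≡ labelsL ts
  labels-leavesAL a i [] = refl
  labels-leavesAL a i (t ∷ ts) = trans (map-++ proj₂ (leavesA (a ++ [ i ]) t) (leavesAL a (suc i) ts))
    (cong₂ _++_ (labels-leavesA (a ++ [ i ]) t) (labels-leavesAL a (suc i) ts))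

All-middle : ∀ {A : Set} {P : A → Set} pre {x} post → All P (pre ++ x ∷ post) → P x
All-middle pre post h = All.head (AllP.++⁻ʳ pre h)

distinct-middle : ∀ pre {x} post → Distinct (pre ++ x ∷ post) →
  All (λ e → proj₁ e ≢ proj₁ x) pre × All (λ e → proj₁ e ≢ proj₁ x) post
distinct-middle [] post (x≢post ∷ _) = [] , All.map ≢-sym x≢post
distinct-middle (e ∷ pre) post (e≢rest ∷ distinct) =
  let pre≢x , post≢x = distinct-middle pre post distinct
  in All-middle pre post e≢rest ∷ pre≢x , post≢x

-- Certificates counted by the stack

firstWith-address : ∀ {P : Address → Set} f L → All (λ e → P (proj₁ e)) L → Maybe.All P (firstWith f L)
firstWith-address f [] [] = Maybe.nothing
firstWith-address f ((c , y) ∷ L) (pc ∷ pL) with f y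
... | true = Maybe.just pc
... | false = firstWith-address f L pL

certOf-below : ∀ b p t → Maybe.All (b ⊑_) (certOf (b , p , t))
certOf-below b zero t = Maybe.nothing
certOf-below b (suc p) (leaf y) = Maybe.nothing
certOf-below b (suc p) (node ts) = firstWith-address _ (leavesA b (node ts)) (leavesA-below b (node ts))

mutual
  certs-below : ∀ b p t → All (λ s → Maybe.All (b ⊑_) (certOf s)) (subs b p t)
  certs-below b p (leaf y) = certOf-below b p (leaf y) ∷ []
  certs-below b p (node ts) =
    certOf-below b p (node ts) ∷ All.map (Maybe.map belowChildFrom-⊑) (certsL-below b (suc p) 0 ts)

  certsL-below : ∀ a p i ts → All (λ s → Maybe.All (BelowChildFrom a i) (certOf s)) (subsL a p i ts)
  certsL-below a p i [] = []
  certsL-below a p i (t ∷ ts) = AllP.++⁺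
    (All.map (Maybe.map below-child) (certs-below (a ++ [ i ]) p t))
    (All.map (Maybe.map belowChildFrom-suc) (certsL-below a p (suc i) ts))

-- cnt T ℓ unfolds to countJust ℓ (map certOf (subs [] 0 T)).
countJust : Address → List (Maybe Address) → ℕ
countJust ℓ ms = length (filter (λ c → ≡-dec ℕ._≟_ c ℓ) (catMaybes ms))

countJust-++ : ∀ ℓ xs ys → countJust ℓ (xs ++ ys) ≡ countJust ℓ xs ℕ.+ countJust ℓ ys
countJust-++ ℓ [] ys = refl
countJust-++ ℓ (nothing ∷ xs) ys = countJust-++ ℓ xs ys
countJust-++ ℓ (just c ∷ xs) ys with does (≡-dec ℕ._≟_ c ℓ)
... | true = cong suc (countJust-++ ℓ xs ys)
... | false = countJust-++ ℓ xs ys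

countJust-avoiding : ∀ ℓ {ms} → All (Maybe.All (_≢ ℓ)) ms → countJust ℓ ms ≡ 0
countJust-avoiding ℓ [] = refl
countJust-avoiding ℓ (Maybe.nothing ∷ h) = countJust-avoiding ℓ h
countJust-avoiding ℓ (Maybe.just {c} c≢ℓ ∷ h) with ≡-dec ℕ._≟_ c ℓ
... | yes c≡ℓ = ⊥-elim (c≢ℓ c≡ℓ)
... | no _ = countJust-avoiding ℓ h

countJust-just-self : ∀ ℓ → countJust ℓ [ just ℓ ] ≡ 1
countJust-just-self ℓ with ≡-dec ℕ._≟_ ℓ ℓ
... | yes _ = refl
... | no ℓ≢ℓ = ⊥-elim (ℓ≢ℓ refl)

-- The first leaf labelled ≤ t₀ is ℓ exactly when the threshold t₀ survives the
-- leaves before ℓ and is then certified by ℓ's label.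
countJust-firstWith : ∀ t₀ pre ℓ y post → All (λ e → proj₁ e ≢ ℓ) pre → All (λ e → proj₁ e ≢ ℓ) post →
  countJust ℓ [ firstWith (λ x → does (x ≤? t₀)) (pre ++ (ℓ , y) ∷ post) ]
    ≡ length (certified y (pendingAfter [ t₀ ] (map proj₂ pre)))
countJust-firstWith t₀ ((c , y′) ∷ pre) ℓ y post (c≢ℓ ∷ pre≢ℓ) post≢ℓ with y′ ≤? t₀
... | yes _ = trans (countJust-avoiding ℓ (Maybe.just c≢ℓ ∷ []))
                (sym (cong (λ zs → length (certified y zs)) (pendingAfter-[] (map proj₂ pre))))
... | no _ = countJust-firstWith t₀ pre ℓ y post pre≢ℓ post≢ℓ
countJust-firstWith t₀ [] ℓ y post [] post≢ℓ with y ≤? t₀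
... | yes _ = countJust-just-self ℓ
... | no _ = countJust-avoiding ℓ (firstWith-address _ post post≢ℓ ∷ [])

countJust-certs-avoiding : ∀ ℓ {P : Address → Set} {ss} → All (λ s → Maybe.All P (certOf s)) ss →
  (∀ {c} → P c → c ≢ ℓ) → countJust ℓ (map certOf ss) ≡ 0
countJust-certs-avoiding ℓ h avoid = countJust-avoiding ℓ (AllP.map⁺ (All.map (Maybe.map avoid) h))

countJust-subsL-∷ : ∀ ℓ a p i t ts → countJust ℓ (map certOf (subsL a p i (t ∷ ts)))
  ≡ countJust ℓ (map certOf (subs (a ++ [ i ]) p t)) ℕ.+ countJust ℓ (map certOf (subsL a p (suc i) ts))
countJust-subsL-∷ ℓ a p i t ts = trans
  (cong (countJust ℓ) (map-++ certOf (subs (a ++ [ i ]) p t) (subsL a p (suc i) ts)))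
  (countJust-++ ℓ (map certOf (subs (a ++ [ i ]) p t)) (map certOf (subsL a p (suc i) ts)))

push : ℕ → Tree → List ℤ → List ℤ
push p (leaf y) qs = qs
push p (node ts) qs = qs ++ [ + p - + 2 ]

mutual
  CountedByStack : (Address → ℕ) → Address → ℕ → Tree → List ℤ → Set
  CountedByStack c b p (leaf y) qs = c b ≡ length (certified y qs)
  CountedByStack c b p (node ts) qs = CountedByStackL c b (suc p) 0 ts qs

  CountedByStackL : (Address → ℕ) → Address → ℕ → ℕ → List Tree → List ℤ → Set
  CountedByStackL c a p i [] qs = ⊤
  CountedByStackL c a p i (t ∷ ts) qs =
    CountedByStack c (a ++ [ i ]) p t (push p t qs) × CountedByStackL c a p (suc i) ts (pendingAfter qs (labels t))

module Counting (T : Tree) where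

  open ≡-Reasoning

  certsBelow : Address → ℕ → Tree → List (Maybe Address)
  certsBelow b p (leaf y) = []
  certsBelow b p (node us) = map certOf (subsL b (suc p) 0 us)

  certifiedAt : ℤ → List ℤ → List (Address × ℤ) → ℕ
  certifiedAt y qs pre = length (certified y (pendingAfter qs (map proj₂ pre)))

  CountSplit : Address → ℕ → Tree → List ℤ → Set
  CountSplit b p t qs = ∀ pre ℓ y post → leavesA b t ≡ pre ++ (ℓ , y) ∷ post →
    cnt T ℓ ≡ countJust ℓ (certsBelow b p t) ℕ.+ certifiedAt y qs pre

  CountSplitL : Address → ℕ → ℕ → List Tree → List ℤ → Set
  CountSplitL a p i ts qs = ∀ pre ℓ y post → leavesAL a i ts ≡ pre ++ (ℓ , y) ∷ post →
    cnt T ℓ ≡ countJust ℓ (map certOf (subsL a p i ts)) ℕ.+ certifiedAt y qs pre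

  countJust-push : ∀ q b t qs pre ℓ y post → leavesA b t ≡ pre ++ (ℓ , y) ∷ post →
    countJust ℓ (map certOf (subs b (suc q) t)) ℕ.+ certifiedAt y qs pre
      ≡ countJust ℓ (certsBelow b (suc q) t) ℕ.+ certifiedAt y (push (suc q) t qs) pre
  countJust-push q b (leaf _) qs pre ℓ y post eq = refl
  countJust-push q b (node us) qs pre ℓ y post eq = begin
    countJust ℓ (own ∷ below) ℕ.+ A
      ≡⟨ cong (ℕ._+ A) (countJust-++ ℓ [ own ] below) ⟩
    countJust ℓ [ own ] ℕ.+ countJust ℓ below ℕ.+ A
      ≡⟨ cong (λ n → n ℕ.+ countJust ℓ below ℕ.+ A) own-counted ⟩
    B ℕ.+ countJust ℓ below ℕ.+ A
      ≡⟨ rearrange B (countJust ℓ below) A ⟩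
    countJust ℓ below ℕ.+ (A ℕ.+ B)
      ≡⟨ cong (countJust ℓ below ℕ.+_) (sym (length-certified-++ y (pendingAfter qs PP) (pendingAfter [ t₀ ] PP))) ⟩
    countJust ℓ below ℕ.+ length (certified y (pendingAfter qs PP ++ pendingAfter [ t₀ ] PP))
      ≡⟨ cong (λ zs → countJust ℓ below ℕ.+ length (certified y zs)) (sym (pendingAfter-++ˡ qs [ t₀ ] PP)) ⟩
    countJust ℓ below ℕ.+ certifiedAt y (qs ++ [ t₀ ]) pre ∎
    where
    t₀ = + suc q - + 2
    PP = map proj₂ pre
    own = certOf (b , suc q , node us)
    below = map certOf (subsL b (suc (suc q)) 0 us)
    A = certifiedAt y qs pre
    B = certifiedAt y [ t₀ ] pre
    own-counted : countJust ℓ [ own ] ≡ B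
    own-counted =
      let pre≢ℓ , post≢ℓ = distinct-middle pre post (subst Distinct eq (leavesA-distinct b (node us)))
      in trans (cong (λ L → countJust ℓ [ firstWith (λ x → does (x ≤? t₀)) L ]) eq)
           (countJust-firstWith t₀ pre ℓ y post pre≢ℓ post≢ℓ)
    rearrange : ∀ x m n → x ℕ.+ m ℕ.+ n ≡ m ℕ.+ (n ℕ.+ x)
    rearrange x m n = trans (ℕP.+-assoc x m n) (trans (ℕP.+-comm x (m ℕ.+ n)) (ℕP.+-assoc m n x))

  mutual
    countedByStack : ∀ q b t qs → CountSplit b (suc q) t qs → CountedByStack (cnt T) b (suc q) t qs
    countedByStack q b (leaf y) qs split = split [] b y [] refl
    countedByStack q b (node us) qs split = countedByStackL (suc q) b 0 us qs split

    countedByStackL : ∀ q a i ts qs → CountSplitL a (suc q) i ts qs → CountedByStackL (cnt T) a (suc q) i ts qs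
    countedByStackL q a i [] qs _ = tt
    countedByStackL q a i (t ∷ ts) qs split =
      countedByStack q b t (push (suc q) t qs) first ,
      countedByStackL q a (suc i) ts (pendingAfter qs (labels t)) rest
      where
      b = a ++ [ i ]
      Lt = leavesA b t
      Lts = leavesAL a (suc i) ts
      certs-t = map certOf (subs b (suc q) t)
      certs-ts = map certOf (subsL a (suc q) (suc i) ts)

      first : CountSplit b (suc q) t (push (suc q) t qs)
      first pre ℓ y post eq = begin
        cnt T ℓ
          ≡⟨ split pre ℓ y (post ++ Lts) (trans (cong (_++ Lts) eq) (++-assoc pre ((ℓ , y) ∷ post) Lts)) ⟩
        countJust ℓ (map certOf (subsL a (suc q) i (t ∷ ts))) ℕ.+ certifiedAt y qs pre
          ≡⟨ cong (ℕ._+ certifiedAt y qs pre) (countJust-subsL-∷ ℓ a (suc q) i t ts) ⟩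
        countJust ℓ certs-t ℕ.+ countJust ℓ certs-ts ℕ.+ certifiedAt y qs pre
          ≡⟨ cong (λ n → countJust ℓ certs-t ℕ.+ n ℕ.+ certifiedAt y qs pre) later-siblings ⟩
        countJust ℓ certs-t ℕ.+ 0 ℕ.+ certifiedAt y qs pre
          ≡⟨ cong (ℕ._+ certifiedAt y qs pre) (ℕP.+-identityʳ (countJust ℓ certs-t)) ⟩
        countJust ℓ certs-t ℕ.+ certifiedAt y qs pre
          ≡⟨ countJust-push q b t qs pre ℓ y post eq ⟩
        countJust ℓ (certsBelow b (suc q) t) ℕ.+ certifiedAt y (push (suc q) t qs) pre ∎
        where
        ℓ-below : b ⊑ ℓ
        ℓ-below = All-middle pre post (subst (All (λ e → b ⊑ proj₁ e)) eq (leavesA-below b t))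
        later-siblings : countJust ℓ certs-ts ≡ 0
        later-siblings = countJust-certs-avoiding ℓ (certsL-below a (suc q) (suc i) ts)
          λ below-j → ≢-sym (below-later-sibling-≢ ℓ-below below-j)

      rest : CountSplitL a (suc q) (suc i) ts (pendingAfter qs (labels t))
      rest pre ℓ y post eq = begin
        cnt T ℓ
          ≡⟨ split (Lt ++ pre) ℓ y post (trans (cong (Lt ++_) eq) (sym (++-assoc Lt pre ((ℓ , y) ∷ post)))) ⟩
        countJust ℓ (map certOf (subsL a (suc q) i (t ∷ ts))) ℕ.+ certifiedAt y qs (Lt ++ pre)
          ≡⟨ cong₂ ℕ._+_ (countJust-subsL-∷ ℓ a (suc q) i t ts) (cong (λ zs → length (certified y zs)) stack) ⟩
        countJust ℓ certs-t ℕ.+ countJust ℓ certs-ts ℕ.+ certifiedAt y (pendingAfter qs (labels t)) pre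
          ≡⟨ cong (λ n → n ℕ.+ countJust ℓ certs-ts ℕ.+ certifiedAt y (pendingAfter qs (labels t)) pre) earlier-sibling ⟩
        countJust ℓ certs-ts ℕ.+ certifiedAt y (pendingAfter qs (labels t)) pre ∎
        where
        ℓ-below : BelowChildFrom a (suc i) ℓ
        ℓ-below = All-middle pre post (subst (All (λ e → BelowChildFrom a (suc i) (proj₁ e))) eq (leavesAL-below a (suc i) ts))
        earlier-sibling : countJust ℓ certs-t ≡ 0
        earlier-sibling = countJust-certs-avoiding ℓ (certs-below b (suc q) t)
          λ below-i → below-later-sibling-≢ below-i ℓ-below
        stack : pendingAfter qs (map proj₂ (Lt ++ pre)) ≡ pendingAfter (pendingAfter qs (labels t)) (map proj₂ pre)
        stack = begin
          pendingAfter qs (map proj₂ (Lt ++ pre))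
            ≡⟨ cong (pendingAfter qs) (map-++ proj₂ Lt pre) ⟩
          pendingAfter qs (map proj₂ Lt ++ map proj₂ pre)
            ≡⟨ cong (λ ls → pendingAfter qs (ls ++ map proj₂ pre)) (labels-leavesA b t) ⟩
          pendingAfter qs (labels t ++ map proj₂ pre)
            ≡⟨ foldl-++ _ qs (labels t) (map proj₂ pre) ⟩
          pendingAfter (pendingAfter qs (labels t)) (map proj₂ pre) ∎

countSplit-root : ∀ ts → Counting.CountSplitL (node ts) [] 1 0 ts []
countSplit-root ts pre ℓ y post eq = sym (trans
  (cong (λ zs → countJust ℓ (map certOf (subsL [] 1 0 ts)) ℕ.+ length (certified y zs)) (pendingAfter-[] (map proj₂ pre)))
  (ℕP.+-identityʳ _))

-- Heights along the traversal

mutual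
  Cond2 : ℕ → Tree → Set
  Cond2 p (leaf y) = ⊤
  Cond2 p (node ts) = Any (_≤ + p - + 2) (labelsL ts) × Cond2s (suc p) ts

  Cond2s : ℕ → List Tree → Set
  Cond2s p [] = ⊤
  Cond2s p (t ∷ ts) = Cond2 p t × Cond2s p ts

-- Thanks to η for pairs, All NodeOKAt is definitionally the predicate in Decorated.
NodeOKAt : Address × ℕ × Tree → Set
NodeOKAt (_ , p , t) = NodeOK p t

mutual
  cond2-subs : ∀ a q t → All NodeOKAt (subs a (suc q) t) → Cond2 (suc q) t
  cond2-subs a q (leaf y) _ = tt
  cond2-subs a q (node us) (ok ∷ oks) = proj₁ (proj₂ ok) , cond2s-subsL a (suc q) 0 us oks

  cond2s-subsL : ∀ a q i ts → All NodeOKAt (subsL a (suc q) i ts) → Cond2s (suc q) ts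
  cond2s-subsL a q i [] _ = tt
  cond2s-subsL a q i (t ∷ ts) oks =
    cond2-subs (a ++ [ i ]) q t (AllP.++⁻ˡ (subs (a ++ [ i ]) (suc q) t) oks) ,
    cond2s-subsL a q (suc i) ts (AllP.++⁻ʳ (subs (a ++ [ i ]) (suc q) t) oks)

module Heights (T : Tree) where

  open ≡-Reasoning

  word : List Event → List Step
  word = concatMap (Pstep T)

  word-visit : ∀ b → word [ visit b ] ≡ replicate (suc (cnt T b)) d
  word-visit b = ++-identityʳ _

  word-child : ∀ xs ys → word (descend ∷ xs ++ ascend ∷ ys) ≡ u ∷ word xs ++ word ys
  word-child xs ys = cong (u ∷_) (concatMap-++ (Pstep T) xs (ascend ∷ ys))

  mutual
    height-word-traverse : ∀ p b t qs → CountedByStack (cnt T) b p t (push p t qs) → Cond2 p t →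
      height (word (traverse b t)) + + suc (length qs) ≡ + length (pendingAfter qs (labels t))
    height-word-traverse p b (leaf y) qs counted _ = begin
      height (word [ visit b ]) + + suc (length qs)
        ≡⟨ cong (λ w → height w + + suc (length qs)) (word-visit b) ⟩
      height (replicate (suc (cnt T b)) d) + + suc (length qs)
        ≡⟨ cong (_+ + suc (length qs)) (height-replicate-d (suc (cnt T b))) ⟩
      - + suc (cnt T b) + + suc (length qs)
        ≡⟨ cong₂ (λ c n → - + suc c + + suc n) counted (sym (length-filter+length-filter-∁ (y ≤?_) qs)) ⟩
      - + suc (length (certified y qs)) + + suc (length (certified y qs) ℕ.+ length (uncertified y qs))
        ≡⟨ cancel (+ length (certified y qs)) (+ length (uncertified y qs)) ⟩
      + length (uncertified y qs) ∎
      where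
      cancel : ∀ x z → - (+ 1 + x) + (+ 1 + (x + z)) ≡ z
      cancel = solve-∀
    height-word-traverse p b (node us) qs counted (certifying , cond2s) = begin
      height (word (traverseL b 0 us)) + + suc (length qs)
        ≡⟨ cong (λ n → height (word (traverseL b 0 us)) + + n) (sym (length-∷ʳ qs t₀)) ⟩
      height (word (traverseL b 0 us)) + + length (qs ++ [ t₀ ])
        ≡⟨ height-word-traverseL (suc p) b 0 us (qs ++ [ t₀ ]) counted cond2s ⟩
      + length (pendingAfter (qs ++ [ t₀ ]) L)
        ≡⟨ cong (λ zs → + length zs) (pendingAfter-++ˡ qs [ t₀ ] L) ⟩
      + length (pendingAfter qs L ++ pendingAfter [ t₀ ] L)
        ≡⟨ cong (λ zs → + length (pendingAfter qs L ++ zs)) (pendingAfter-certifying t₀ L certifying) ⟩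
      + length (pendingAfter qs L ++ [])
        ≡⟨ cong (λ zs → + length zs) (++-identityʳ (pendingAfter qs L)) ⟩
      + length (pendingAfter qs L) ∎
      where
      t₀ = + p - + 2
      L = labelsL us

    height-word-traverseL : ∀ p a i ts qs → CountedByStackL (cnt T) a p i ts qs → Cond2s p ts →
      height (word (traverseL a i ts)) + + length qs ≡ + length (pendingAfter qs (labelsL ts))
    height-word-traverseL p a i [] qs _ _ = ℤP.+-identityˡ (+ length qs)
    height-word-traverseL p a i (t ∷ ts) qs (counted , counteds) (cond2 , cond2s) = begin
      height (word (traverseL a i (t ∷ ts))) + + length qs
        ≡⟨ cong (λ w → height w + + length qs) (word-child (traverse b t) (traverseL a (suc i) ts)) ⟩
      height (u ∷ word (traverse b t) ++ word (traverseL a (suc i) ts)) + + length qs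
        ≡⟨ height-u∷-++ {word (traverse b t)} (height-word-traverse p b t qs counted cond2)
             (height-word-traverseL p a (suc i) ts (pendingAfter qs (labels t)) counteds cond2s) ⟩
      + length (pendingAfter (pendingAfter qs (labels t)) (labelsL ts))
        ≡⟨ cong (λ zs → + length zs) (sym (foldl-++ _ qs (labels t) (labelsL ts))) ⟩
      + length (pendingAfter qs (labels t ++ labelsL ts)) ∎
      where
      b = a ++ [ i ]

  mutual
    prefixHeights-traverse : ∀ p b t qs → CountedByStack (cnt T) b p t (push p t qs) → Cond2 p t →
      PrefixHeights≥ (- + suc (length qs)) (word (traverse b t))
    prefixHeights-traverse p b (leaf y) qs counted _ =
      subst (PrefixHeights≥ (- + suc (length qs))) (sym (word-visit b))
        (prefixHeights-mono (ℤP.neg-mono-≤ (ℤ.+≤+ (s≤s count≤length)))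
          (prefixHeights-replicate-d (suc (cnt T b))))
      where
      count≤length : cnt T b ℕ.≤ length qs
      count≤length = subst (ℕ._≤ length qs) (sym counted) (length-filter (y ≤?_) qs)
    prefixHeights-traverse p b (node us) qs counted (_ , cond2s) =
      subst (λ n → PrefixHeights≥ (- + n) (word (traverseL b 0 us))) (length-∷ʳ qs (+ p - + 2))
        (prefixHeights-traverseL (suc p) b 0 us (qs ++ [ + p - + 2 ]) counted cond2s)

    prefixHeights-traverseL : ∀ p a i ts qs → CountedByStackL (cnt T) a p i ts qs → Cond2s p ts →
      PrefixHeights≥ (- + length qs) (word (traverseL a i ts))
    prefixHeights-traverseL p a i [] qs _ _ zero = ℤP.neg-≤-pos
    prefixHeights-traverseL p a i [] qs _ _ (suc k) = ℤP.neg-≤-pos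
    prefixHeights-traverseL p a i (t ∷ ts) qs (counted , counteds) (cond2 , cond2s) =
      subst (PrefixHeights≥ (- + length qs)) (sym (word-child (traverse b t) (traverseL a (suc i) ts)))
        (prefixHeights-u∷ ℤP.neg-≤-pos
          (prefixHeights-++ (prefixHeights-traverse p b t qs counted cond2)
            (prefixHeights-traverseL p a (suc i) ts (pendingAfter qs (labels t)) counteds cond2s)
            (ℤP.≤-reflexive (balance {height (word (traverse b t))} (height-word-traverse p b t qs counted cond2))))
          (ℤP.≤-reflexive (neg-suc (+ length qs))))
      where
      b = a ++ [ i ]
      neg-suc : ∀ x → - x ≡ + 1 + - (+ 1 + x)
      neg-suc = solve-∀
      balance : ∀ {x n m} → x + n ≡ m → - n ≡ x + - m
      balance {x} {n} refl = rearrange x n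
        where
        rearrange : ∀ x n → - n ≡ x + - (x + n)
        rearrange = solve-∀

  mutual
    height-upToVisit-traverse : ∀ q a i t qs r →
      CountedByStack (cnt T) (a ++ [ i ]) (suc q) t (push (suc q) t qs) → Cond2 (suc q) t →
      All (-[1+ 0 ] ≤_) qs → at t r ≡ just (leaf -[1+ 0 ]) → ∀ rest →
      height (word (upToVisit (a ++ i ∷ r) (traverse (a ++ [ i ]) t ++ rest))) + + suc (length qs) ≡ + 0
    height-upToVisit-traverse q a i (leaf _) qs [] counted _ thresholds refl rest = begin
      height (word (upToVisit b (visit b ∷ rest))) + + suc (length qs)
        ≡⟨ cong (λ es → height (word es) + + suc (length qs)) (upToVisit-hit b rest) ⟩
      height (word [ visit b ]) + + suc (length qs)
        ≡⟨ cong (λ w → height w + + suc (length qs)) (word-visit b) ⟩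
      height (replicate (suc (cnt T b)) d) + + suc (length qs)
        ≡⟨ cong (_+ + suc (length qs)) (height-replicate-d (suc (cnt T b))) ⟩
      - + suc (cnt T b) + + suc (length qs)
        ≡⟨ cong (λ n → - + suc n + + suc (length qs)) (trans counted (cong length (filter-all (-[1+ 0 ] ≤?_) thresholds))) ⟩
      - + suc (length qs) + + suc (length qs)
        ≡⟨ ℤP.+-inverseˡ (+ suc (length qs)) ⟩
      + 0 ∎
      where
      b = a ++ [ i ]
    height-upToVisit-traverse q a i (node us) qs (k ∷ r) counted (_ , cond2s) thresholds free rest = begin
      height (word (upToVisit (a ++ i ∷ k ∷ r) E)) + + suc (length qs)
        ≡⟨ cong₂ (λ ℓ n → height (word (upToVisit ℓ E)) + + n) (sym address) (sym (length-∷ʳ qs t₀)) ⟩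
      height (word (upToVisit (b ++ (k ℕ.+ 0) ∷ r) E)) + + length (qs ++ [ t₀ ])
        ≡⟨ height-upToVisit-traverseL (suc q) b 0 us (qs ++ [ t₀ ]) k r counted cond2s
             (AllP.++⁺ thresholds (threshold-≥-1 q ∷ [])) free rest ⟩
      + 0 ∎
      where
      b = a ++ [ i ]
      t₀ = + suc q - + 2
      E = traverseL b 0 us ++ rest
      address : b ++ (k ℕ.+ 0) ∷ r ≡ a ++ i ∷ k ∷ r
      address = trans (cong (λ j → b ++ j ∷ r) (ℕP.+-identityʳ k)) (++-assoc a [ i ] (k ∷ r))

    height-upToVisit-traverseL : ∀ q a i ts qs k r →
      CountedByStackL (cnt T) a (suc q) i ts qs → Cond2s (suc q) ts →
      All (-[1+ 0 ] ≤_) qs → atL ts k r ≡ just (leaf -[1+ 0 ]) → ∀ rest →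
      height (word (upToVisit (a ++ (k ℕ.+ i) ∷ r) (traverseL a i ts ++ rest))) + + length qs ≡ + 0
    height-upToVisit-traverseL q a i (t ∷ ts) qs zero r (counted , _) (cond2 , _) thresholds free rest =
      begin
      height (word (upToVisit ℓ ((descend ∷ X ++ ascend ∷ R) ++ rest))) + + length qs
        ≡⟨ cong (λ es → height (word (upToVisit ℓ (descend ∷ es))) + + length qs) (++-assoc X (ascend ∷ R) rest) ⟩
      height (u ∷ word (upToVisit ℓ (X ++ ascend ∷ R ++ rest))) + + length qs
        ≡⟨ height-u∷ {word (upToVisit ℓ (X ++ ascend ∷ R ++ rest))}
             (height-upToVisit-traverse q a i t qs r counted cond2 thresholds free (ascend ∷ R ++ rest)) ⟩
      + 0 ∎
      where
      ℓ = a ++ i ∷ r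
      X = traverse (a ++ [ i ]) t
      R = traverseL a (suc i) ts
    height-upToVisit-traverseL q a i (t ∷ ts) qs (suc k) r (counted , counteds) (cond2 , cond2s) thresholds free rest =
      begin
      height (word (upToVisit ℓ ((descend ∷ X ++ ascend ∷ R) ++ rest))) + + length qs
        ≡⟨ cong (λ es → height (word (descend ∷ es)) + + length qs) skip ⟩
      height (word (descend ∷ X ++ ascend ∷ upToVisit ℓ (R ++ rest))) + + length qs
        ≡⟨ cong (λ w → height w + + length qs) (word-child X (upToVisit ℓ (R ++ rest))) ⟩
      height (u ∷ word X ++ word (upToVisit ℓ (R ++ rest))) + + length qs
        ≡⟨ height-u∷-++ {word X} (height-word-traverse (suc q) (a ++ [ i ]) t qs counted cond2) (begin
             height (word (upToVisit ℓ (R ++ rest))) + + length qs₁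
               ≡⟨ cong (λ j → height (word (upToVisit (a ++ j ∷ r) (R ++ rest))) + + length qs₁) (sym (ℕP.+-suc k i)) ⟩
             height (word (upToVisit (a ++ (k ℕ.+ suc i) ∷ r) (R ++ rest))) + + length qs₁
               ≡⟨ height-upToVisit-traverseL q a (suc i) ts qs₁ k r counteds cond2s
                    (All-pendingAfter qs (labels t) thresholds) free rest ⟩
             + 0 ∎) ⟩
      + 0 ∎
      where
      ℓ = a ++ suc (k ℕ.+ i) ∷ r
      X = traverse (a ++ [ i ]) t
      R = traverseL a (suc i) ts
      qs₁ = pendingAfter qs (labels t)
      skip : upToVisit ℓ ((X ++ ascend ∷ R) ++ rest) ≡ X ++ ascend ∷ upToVisit ℓ (R ++ rest)
      skip = trans (cong (upToVisit ℓ) (++-assoc X (ascend ∷ R) rest))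
        (upToVisit-skip ℓ (ascend ∷ R ++ rest)
          (traverse-notVisiting-sibling a t (ℕP.m≢1+n+m i) (⊑-child a (suc (k ℕ.+ i)) r)))

  prefixHeights-upToVisit : ∀ {c} ℓ es →
    PrefixHeights≥ c (word es) → PrefixHeights≥ c (word (upToVisit ℓ es))
  prefixHeights-upToVisit {c} ℓ es h with upToVisit-prefix ℓ es
  ... | rest , eq = prefixHeights-++⁻ˡ (word (upToVisit ℓ es)) (word rest)
    (subst (PrefixHeights≥ c) (trans (cong word (sym eq)) (concatMap-++ (Pstep T) (upToVisit ℓ es) rest)) h)

  height-upToVisit-root : ∀ ts k r → CountedByStackL (cnt T) [] 1 0 ts [] → Cond2s 1 ts →
    atL ts k r ≡ just (leaf -[1+ 0 ]) → height (word (upToVisit (k ∷ r) (traverseL [] 0 ts))) ≡ + 0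
  height-upToVisit-root ts k r counted cond2s free = begin
    height (word (upToVisit (k ∷ r) E))
      ≡⟨ sym (ℤP.+-identityʳ _) ⟩
    height (word (upToVisit (k ∷ r) E)) + + 0
      ≡⟨ cong₂ (λ j es → height (word (upToVisit (j ∷ r) es)) + + 0) (sym (ℕP.+-identityʳ k)) (sym (++-identityʳ E)) ⟩
    height (word (upToVisit ((k ℕ.+ 0) ∷ r) (E ++ []))) + + 0
      ≡⟨ height-upToVisit-traverseL 0 [] 0 ts [] k r counted cond2s [] free [] ⟩
    + 0 ∎
    where
    E = traverseL [] 0 ts

lemma3p6 : (T : Tree) → Decorated T → (ℓ : Address) → FreeLeaf T ℓ →
    IsDyck (Pprefix T ℓ)
lemma3p6 (leaf x) () ℓ free
lemma3p6 (node ts) decorated [] ()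
lemma3p6 (node []) decorated (k ∷ r) ()
lemma3p6 (node (t ∷ ts)) (_ ∷ oks) (k ∷ r) free =
  (λ ()) ,
  height-upToVisit-root (t ∷ ts) k r counted cond2s free ,
  prefixHeights-upToVisit (k ∷ r) (traverseL [] 0 (t ∷ ts))
    (prefixHeights-traverseL 1 [] 0 (t ∷ ts) [] counted cond2s)
  where
  open Heights (node (t ∷ ts))
  counted : CountedByStackL (cnt (node (t ∷ ts))) [] 1 0 (t ∷ ts) []
  counted = Counting.countedByStackL (node (t ∷ ts)) 0 [] 0 (t ∷ ts) [] (countSplit-root (t ∷ ts))
  cond2s : Cond2s 1 (t ∷ ts)
  cond2s = cond2s-subsL [] 0 0 (t ∷ ts) oks
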